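{- For $M \ge 1$ let $$S = \left\{ \left( \frac{\nu}{m}, \frac{\nu^2}{m} \right) \in \mathbb{R}^2/\mathbb{Z}^2 \ :\ m \in \mathbb{Z},\ M < m \le 2M,\ \nu \in \mathbb{Z}/m\mathbb{Z},\ \nu^3 \equiv 2 \pmod m \right\}.$$ Then for any disc $D$ in $\mathbb{R}^2/\mathbb{Z}^2$ of radius $\frac{1}{M}$ (with respect to the metric induced from the Euclidean metric), $$\#(S \cap D) \ll 1,$$ with an implied constant independent of $M$ and $D$.
   Formalization: The parameter M is rational, and the disc D is centred at a point of ℝ²/ℤ² with rational coordinates. -}

module Defs where

open import Data.Nat as ℕ using (ℕ; zero; suc)
open import Data.Integer as ℤ using (ℤ; +_)
open import Data.Integer.Divisibility using () renaming (_∣_ to _∣ℤ_)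
open import Data.Rational as Q using (ℚ; _/_; _≤_; _<_; _+_; _-_; _*_; 0ℚ; 1ℚ)
open import Data.Fin using (Fin; toℕ)
open import Data.Product using (_×_; _,_; proj₁; proj₂; ∃-syntax)
open import Relation.Binary.PropositionalEquality using (_≡_)

fromℤ : ℤ → ℚ
fromℤ a = a / 1

-- integer numerator over natural denominator (denominator 0 never occurs below)
_÷_ : ℤ → ℕ → ℚ
a ÷ zero = 0ℚ
a ÷ suc k = a / suc k

-- Points of R^2/Z^2 with rational coordinates, given by representatives in ℚ × ℚ.
Pt : Set
Pt = ℚ × ℚ

_~_ : Pt → Pt → Set
(x₁ , y₁) ~ (x₂ , y₂) = (∃[ a ] (x₁ - x₂ ≡ fromℤ a)) × (∃[ b ] (y₁ - y₂ ≡ fromℤ b))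

sq : ℚ → ℚ
sq x = x * x

-- p lies in the closed disc of radius 1/M around c, for the metric on R^2/Z^2
-- induced by the Euclidean metric:  min_{a,b ∈ ℤ} |p - c - (a,b)|² ≤ 1/M²,
-- written as M² · |p - c - (a,b)|² ≤ 1.
InDisc : (M : ℚ) → (c : Pt) → Pt → Set
InDisc M (c₁ , c₂) (x , y) =
  ∃[ a ] ∃[ b ] (sq M * (sq (x - c₁ - fromℤ a) + sq (y - c₂ - fromℤ b)) ≤ 1ℚ)

record SIndex (M : ℚ) : Set where
  constructor sidx
  field
    m     : ℕ
    ν     : Fin m
    M<m   : M < fromℤ (+ m)
    m≤2M  : fromℤ (+ m) ≤ (fromℤ (+ 2)) * M
    cube  : (+ m) ∣ℤ ((+ toℕ ν) ℤ.* (+ toℕ ν) ℤ.* (+ toℕ ν) ℤ.- + 2)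

point : ∀ {M} → SIndex M → Pt
point (sidx m ν _ _ _) = ((+ toℕ ν) ÷ m , ((+ toℕ ν) ℤ.* (+ toℕ ν)) ÷ m)

{-# OPTIONS --safe #-}
module Submission where

-- Let N(a, b, c) be the norm of a + b∛2 + c∛4. If ν³ ≡ 2 (mod m), then N vanishes to second
-- order at (ν², ν, 1) modulo m: m² divides N there and m divides its derivative. For two points
-- (ν/m, ν²/m) and (μ/n, μ²/n) of S in a common disc of radius 1/M, shift the numerators by
-- multiples of m and n so that the points lie in the disc itself; the integer vector
-- n (ν², ν, 1) − m (μ², μ, 1) then has norm divisible by (mn)², while its entries are O(m)
-- since m, n ≍ M. So for large M the norm vanishes, and as N has no nontrivial integer zeros
-- (2-adic descent) the vector vanishes: the two points coincide. For bounded M, S is finite.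

module CubicNorm where
  open import Data.Integer
  open import Data.Integer.Divisibility.Signed
  open import Data.Integer.Tactic.RingSolver
  open import Relation.Binary.PropositionalEquality

  -- norm t a b c is the norm of a + b ∛t + c ∛t² from ℚ(∛t) to ℚ.
  norm : ℤ → ℤ → ℤ → ℤ → ℤ
  norm t a b c = a * a * a + t * (b * b * b) + t * t * (c * c * c) - + 3 * t * (a * b * c)

  -- the derivative of norm t at (a, b, c) in the direction (a′, b′, c′)
  norm′ : ℤ → ℤ → ℤ → ℤ → ℤ → ℤ → ℤ → ℤ
  norm′ t a b c a′ b′ c′ =
    + 3 * (a * a * a′ + t * (b * b * b′) + t * t * (c * c * c′))
      - + 3 * t * (a′ * b * c + a * b′ * c + a * b * c′)

  -- The ring solver does not unfold definitions, so each identity about norm is proved for its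
  -- unfolded form.
  norm-[n*α-m*β] : ∀ t n m a b c a′ b′ c′ →
    norm t (n * a - m * a′) (n * b - m * b′) (n * c - m * c′)
      ≡ n * n * n * norm t a b c - n * n * m * norm′ t a b c a′ b′ c′
        + n * m * m * norm′ t a′ b′ c′ a b c - m * m * m * norm t a′ b′ c′
  norm-[n*α-m*β] = unfolded
    where
    unfolded : ∀ t n m a b c a′ b′ c′ →
      let A = n * a - m * a′ ; B = n * b - m * b′ ; C = n * c - m * c′ in
      A * A * A + t * (B * B * B) + t * t * (C * C * C) - + 3 * t * (A * B * C)
        ≡ n * n * n * (a * a * a + t * (b * b * b) + t * t * (c * c * c) - + 3 * t * (a * b * c))
          - n * n * m * (+ 3 * (a * a * a′ + t * (b * b * b′) + t * t * (c * c * c′))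
                         - + 3 * t * (a′ * b * c + a * b′ * c + a * b * c′))
          + n * m * m * (+ 3 * (a′ * a′ * a + t * (b′ * b′ * b) + t * t * (c′ * c′ * c))
                         - + 3 * t * (a * b′ * c′ + a′ * b * c′ + a′ * b′ * c))
          - m * m * m * (a′ * a′ * a′ + t * (b′ * b′ * b′) + t * t * (c′ * c′ * c′)
                         - + 3 * t * (a′ * b′ * c′))
    unfolded = solve-∀

  norm-[a*t] : ∀ t a b c → norm t (a * t) b c ≡ t * norm t b c a
  norm-[a*t] = unfolded
    where
    unfolded : ∀ t a b c → let A = a * t in
      A * A * A + t * (b * b * b) + t * t * (c * c * c) - + 3 * t * (A * b * c)
        ≡ t * (b * b * b + t * (c * c * c) + t * t * (a * a * a) - + 3 * t * (b * c * a))
    unfolded = solve-∀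

  x-y≡z⇒y≡x-z : ∀ {x y z} → x - y ≡ z → y ≡ x - z
  x-y≡z⇒y≡x-z {x} {y} refl = y≡x-[x-y] x y
    where
    y≡x-[x-y] : ∀ x y → y ≡ x - (x - y)
    y≡x-[x-y] = solve-∀

  norm-at-root : ∀ {t m P Q} → m ∣ P * P * P - t → m ∣ P * P - Q → m * m ∣ norm t Q P (+ 1)
  norm-at-root {t} {m} {P} {Q} (divides r eᵣ) (divides k eₖ)
    with refl ← x-y≡z⇒y≡x-z {P * P * P} {t} eᵣ | refl ← x-y≡z⇒y≡x-z {P * P} {Q} eₖ =
    divides (r * r - + 3 * P * r * k + + 3 * P * P * k * k - k * k * k * m) (unfolded P r k m)
    where
    unfolded : ∀ P r k m → let t = P * P * P - r * m ; Q = P * P - k * m in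
      Q * Q * Q + t * (P * P * P) + t * t * (+ 1 * + 1 * + 1) - + 3 * t * (Q * P * + 1)
        ≡ (r * r - + 3 * P * r * k + + 3 * P * P * k * k - k * k * k * m) * (m * m)
    unfolded = solve-∀

  norm′-at-root : ∀ {t m P Q} → m ∣ P * P * P - t → m ∣ P * P - Q →
                  ∀ a b c → m ∣ norm′ t Q P (+ 1) a b c
  norm′-at-root {t} {m} {P} {Q} (divides r eᵣ) (divides k eₖ) a b c
    with refl ← x-y≡z⇒y≡x-z {P * P * P} {t} eᵣ | refl ← x-y≡z⇒y≡x-z {P * P} {Q} eₖ =
    divides (a * (+ 3 * k * k * m - + 6 * P * P * k + + 3 * P * r)
             + + 3 * (P * P * P - r * m) * (k * b + (P * k - r) * c))
            (unfolded P r k m a b c)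
    where
    unfolded : ∀ P r k m a b c → let t = P * P * P - r * m ; Q = P * P - k * m in
      + 3 * (Q * Q * a + t * (P * P * b) + t * t * (+ 1 * + 1 * c))
        - + 3 * t * (a * P * + 1 + Q * b * + 1 + Q * P * c)
        ≡ (a * (+ 3 * k * k * m - + 6 * P * P * k + + 3 * P * r)
           + + 3 * (P * P * P - r * m) * (k * b + (P * k - r) * c)) * m
    unfolded = solve-∀

  norm-[n*α-m*β]-∣ : ∀ {t m n a b c a′ b′ c′} →
    m * m ∣ norm t a b c → m ∣ norm′ t a b c a′ b′ c′ →
    n * n ∣ norm t a′ b′ c′ → n ∣ norm′ t a′ b′ c′ a b c →
    (m * n) * (m * n) ∣ norm t (n * a - m * a′) (n * b - m * b′) (n * c - m * c′)
  norm-[n*α-m*β]-∣ {t} {m} {n} {a} {b} {c} {a′} {b′} {c′}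
                   (divides g₁ e₁) (divides g₂ e₂) (divides g₃ e₃) (divides g₄ e₄) =
    divides (n * g₁ - g₂ + g₄ - m * g₃) (begin
      norm t (n * a - m * a′) (n * b - m * b′) (n * c - m * c′)
        ≡⟨ norm-[n*α-m*β] t n m a b c a′ b′ c′ ⟩
      n * n * n * norm t a b c - n * n * m * norm′ t a b c a′ b′ c′
        + n * m * m * norm′ t a′ b′ c′ a b c - m * m * m * norm t a′ b′ c′
        ≡⟨ cong₂ _-_ (cong₂ _+_ (cong₂ _-_ (cong (n * n * n *_) e₁) (cong (n * n * m *_) e₂))
                                (cong (n * m * m *_) e₄))
                     (cong (m * m * m *_) e₃) ⟩
      n * n * n * (g₁ * (m * m)) - n * n * m * (g₂ * m)
        + n * m * m * (g₄ * n) - m * m * m * (g₃ * (n * n))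
        ≡⟨ regroup n m g₁ g₂ g₃ g₄ ⟩
      (n * g₁ - g₂ + g₄ - m * g₃) * ((m * n) * (m * n)) ∎)
    where
    open ≡-Reasoning
    regroup : ∀ n m g₁ g₂ g₃ g₄ →
      n * n * n * (g₁ * (m * m)) - n * n * m * (g₂ * m) + n * m * m * (g₄ * n) - m * m * m * (g₃ * (n * n))
        ≡ (n * g₁ - g₂ + g₄ - m * g₃) * ((m * n) * (m * n))
    regroup = solve-∀

  cube-root-shift : ∀ {t m ν} a → m ∣ ν * ν * ν - t → m ∣ (ν - a * m) * (ν - a * m) * (ν - a * m) - t
  cube-root-shift {t} {m} {ν} a m∣ν³-t = subst (m ∣_) (sym (expand t m ν a))
    (∣m∣n⇒∣m-n m∣ν³-t (∣n⇒∣m*n (+ 3 * ν * ν * a - + 3 * ν * a * a * m + a * a * a * m * m) ∣-refl))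
    where
    expand : ∀ t m ν a → let P = ν - a * m in
      P * P * P - t ≡ (ν * ν * ν - t) - (+ 3 * ν * ν * a - + 3 * ν * a * a * m + a * a * a * m * m) * m
    expand = solve-∀

  square-shift : ∀ m ν a b → m ∣ (ν - a * m) * (ν - a * m) - (ν * ν - b * m)
  square-shift m ν a b = divides (b + a * a * m - + 2 * a * ν) (expand m ν a b)
    where
    expand : ∀ m ν a b → (ν - a * m) * (ν - a * m) - (ν * ν - b * m) ≡ (b + a * a * m - + 2 * a * ν) * m
    expand = solve-∀

module NormAnisotropy where
  open import Data.Nat as ℕ using (ℕ; zero; suc; z≤n)
  import Data.Nat.Properties as ℕ
  import Data.Nat.Divisibility as ℕ
  open import Data.Nat.Primality using (Prime; euclidsLemma; prime⇒nonZero; prime⇒nonTrivial)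
  open import Data.Integer hiding (suc)
  open import Data.Integer.Properties using (abs-*; *-cancelˡ-≡; *-zeroʳ; ∣i∣≡0⇒i≡0)
  open import Data.Integer.Divisibility.Signed
  open import Data.Integer.Tactic.RingSolver
  open import Data.Product using (∃; _,_; _×_)
  open import Data.Sum using (inj₁; inj₂)
  open import Relation.Binary.PropositionalEquality
  open CubicNorm

  module _ {p : ℕ} (prime : Prime p) where

    private instance
      p≢0 = prime⇒nonZero prime

    ∣cube⇒∣ : ∀ {a} → + p ∣ a * a * a → + p ∣ a
    ∣cube⇒∣ {a} p∣a³ = ∣ᵤ⇒∣ (∣n*n*n⇒∣n (subst (p ℕ.∣_) ∣a³∣≡∣a∣³ (∣⇒∣ᵤ p∣a³)))
      where
      ∣a³∣≡∣a∣³ : ∣ a * a * a ∣ ≡ ∣ a ∣ ℕ.* ∣ a ∣ ℕ.* ∣ a ∣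
      ∣a³∣≡∣a∣³ = trans (abs-* (a * a) a) (cong (ℕ._* ∣ a ∣) (abs-* a a))
      ∣n*n⇒∣n : ∀ {n} → p ℕ.∣ n ℕ.* n → p ℕ.∣ n
      ∣n*n⇒∣n {n} p∣n² with euclidsLemma n n prime p∣n²
      ... | inj₁ p∣n = p∣n
      ... | inj₂ p∣n = p∣n
      ∣n*n*n⇒∣n : ∀ {n} → p ℕ.∣ n ℕ.* n ℕ.* n → p ℕ.∣ n
      ∣n*n*n⇒∣n {n} p∣n³ with euclidsLemma (n ℕ.* n) n prime p∣n³
      ... | inj₁ p∣n² = ∣n*n⇒∣n p∣n²
      ... | inj₂ p∣n  = p∣n

    norm≡0⇒∣ : ∀ {a b c} → norm (+ p) a b c ≡ 0ℤ → + p ∣ a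
    norm≡0⇒∣ {a} {b} {c} N≡0 = ∣cube⇒∣ (∣m+n∣n⇒∣m p∣N (∣m⇒∣m*n _ ∣-refl))
      where
      p∣N : + p ∣ a * a * a + + p * (b * b * b + + p * (c * c * c) - + 3 * (a * b * c))
      p∣N = divides 0ℤ (trans (unfolded (+ p) a b c) N≡0)
        where
        unfolded : ∀ t a b c →
          a * a * a + t * (b * b * b + t * (c * c * c) - + 3 * (a * b * c))
            ≡ a * a * a + t * (b * b * b) + t * t * (c * c * c) - + 3 * t * (a * b * c)
        unfolded = solve-∀

    norm≡0-rotate : ∀ {a b c} → norm (+ p) a b c ≡ 0ℤ → ∃ λ a′ → a ≡ a′ * + p × norm (+ p) b c a′ ≡ 0ℤ
    norm≡0-rotate {a} {b} {c} N≡0 = rotate (norm≡0⇒∣ N≡0)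
      where
      rotate : + p ∣ a → ∃ λ a′ → a ≡ a′ * + p × norm (+ p) b c a′ ≡ 0ℤ
      rotate (divides a′ a≡a′p) = a′ , a≡a′p , *-cancelˡ-≡ (+ p) (norm (+ p) b c a′) 0ℤ (begin
        + p * norm (+ p) b c a′    ≡⟨ norm-[a*t] (+ p) a′ b c ⟨
        norm (+ p) (a′ * + p) b c  ≡⟨ subst (λ a → norm (+ p) a b c ≡ 0ℤ) a≡a′p N≡0 ⟩
        0ℤ                         ≡⟨ *-zeroʳ (+ p) ⟨
        + p * 0ℤ                   ∎)
        where open ≡-Reasoning

    -- Three rotations lead from a zero (a, b, c) to a zero (a′, b′, c′) with a = a′ p, so the
    -- descent on ∣ a ∣ ends at a = 0.
    norm≡0⇒a≡0 : ∀ {a b c} → norm (+ p) a b c ≡ 0ℤ → a ≡ 0ℤ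
    norm≡0⇒a≡0 {a} = descend ∣ a ∣ ℕ.≤-refl
      where
      shrink : ∀ {x k} → x ℕ.* p ℕ.≤ suc k → x ℕ.≤ k
      shrink {zero}  _         = z≤n
      shrink {suc x} x*p≤1+k = ℕ.≤-pred (ℕ.<-≤-trans (ℕ.m<m*n (suc x) p 1<p) x*p≤1+k)
        where 1<p = ℕ.nonTrivial⇒n>1 p {{prime⇒nonTrivial prime}}
      descend : ∀ k {a b c} → ∣ a ∣ ℕ.≤ k → norm (+ p) a b c ≡ 0ℤ → a ≡ 0ℤ
      descend zero    ∣a∣≤0 _ = ∣i∣≡0⇒i≡0 (ℕ.n≤0⇒n≡0 ∣a∣≤0)
      descend (suc k) {a} {b} {c} ∣a∣≤1+k N≡0 =
        let a′ , a≡a′p , N₁≡0 = norm≡0-rotate {a} {b} {c} N≡0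
            b′ , _     , N₂≡0 = norm≡0-rotate {b} {c} {a′} N₁≡0
            c′ , _     , N₃≡0 = norm≡0-rotate {c} {a′} {b′} N₂≡0
            ∣a′∣*p≤1+k = subst (ℕ._≤ suc k) (abs-* a′ (+ p)) (subst (λ a → ∣ a ∣ ℕ.≤ suc k) a≡a′p ∣a∣≤1+k)
        in trans a≡a′p (cong (_* + p) (descend k {a′} {b′} {c′} (shrink ∣a′∣*p≤1+k) N₃≡0))

    norm≡0⇒b≡0 : ∀ {a b c} → norm (+ p) a b c ≡ 0ℤ → b ≡ 0ℤ
    norm≡0⇒b≡0 {a} {b} {c} N≡0 =
      let a′ , _ , N′≡0 = norm≡0-rotate {a} {b} {c} N≡0 in norm≡0⇒a≡0 {b} {c} {a′} N′≡0

module NormBound where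
  open import Data.Nat as ℕ using (zero; suc; _≤_; _<_)
  import Data.Nat.Properties as ℕ
  import Data.Nat.Divisibility as ℕ
  open import Data.Nat.Tactic.RingSolver
  open import Data.Integer as ℤ using (+_; ∣_∣; 0ℤ)
  open import Data.Integer.Properties using (abs-*; ∣i+j∣≤∣i∣+∣j∣; ∣i-j∣≤∣i∣+∣j∣; ∣i∣≡0⇒i≡0)
  open import Data.Integer.Divisibility.Signed using (_∣_; ∣⇒∣ᵤ)
  open import Relation.Binary.PropositionalEquality
  open import Relation.Nullary using (contradiction)
  open CubicNorm
  open ℕ.≤-Reasoning

  ∣x*y*z∣≤ : ∀ x y z {B} → ∣ x ∣ ≤ B → ∣ y ∣ ≤ B → ∣ z ∣ ≤ B → ∣ x ℤ.* y ℤ.* z ∣ ≤ B ℕ.* B ℕ.* B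
  ∣x*y*z∣≤ x y z ∣x∣≤B ∣y∣≤B ∣z∣≤B = begin
    ∣ x ℤ.* y ℤ.* z ∣          ≡⟨ trans (abs-* (x ℤ.* y) z) (cong (ℕ._* ∣ z ∣) (abs-* x y)) ⟩
    ∣ x ∣ ℕ.* ∣ y ∣ ℕ.* ∣ z ∣  ≤⟨ ℕ.*-mono-≤ (ℕ.*-mono-≤ ∣x∣≤B ∣y∣≤B) ∣z∣≤B ⟩
    _                          ∎

  ∣k*w∣≤ : ∀ k {w W} → ∣ w ∣ ≤ W → ∣ k ℤ.* w ∣ ≤ ∣ k ∣ ℕ.* W
  ∣k*w∣≤ k {w} ∣w∣≤W = ℕ.≤-trans (ℕ.≤-reflexive (abs-* k w)) (ℕ.*-monoʳ-≤ ∣ k ∣ ∣w∣≤W)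

  ∣norm∣≤ : ∀ t a b c {B} → ∣ a ∣ ≤ B → ∣ b ∣ ≤ B → ∣ c ∣ ≤ B →
            ∣ norm (+ t) a b c ∣ ≤ (1 ℕ.+ t ℕ.+ t ℕ.* t ℕ.+ 3 ℕ.* t) ℕ.* (B ℕ.* B ℕ.* B)
  ∣norm∣≤ t a b c {B} ∣a∣≤B ∣b∣≤B ∣c∣≤B = begin
    ∣ a³ ℤ.+ T₁ ℤ.+ T₂ ℤ.- T₃ ∣
      ≤⟨ ℕ.≤-trans (∣i-j∣≤∣i∣+∣j∣ (a³ ℤ.+ T₁ ℤ.+ T₂) T₃)
           (ℕ.+-monoˡ-≤ _ (ℕ.≤-trans (∣i+j∣≤∣i∣+∣j∣ (a³ ℤ.+ T₁) T₂) (ℕ.+-monoˡ-≤ _ (∣i+j∣≤∣i∣+∣j∣ a³ T₁)))) ⟩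
    ∣ a³ ∣ ℕ.+ ∣ T₁ ∣ ℕ.+ ∣ T₂ ∣ ℕ.+ ∣ T₃ ∣
      ≤⟨ ℕ.+-mono-≤ (ℕ.+-mono-≤ (ℕ.+-mono-≤ (∣x*y*z∣≤ a a a ∣a∣≤B ∣a∣≤B ∣a∣≤B)
                                            (∣k*w∣≤ (+ t) (∣x*y*z∣≤ b b b ∣b∣≤B ∣b∣≤B ∣b∣≤B)))
                                 (∣k*w∣≤ (+ t ℤ.* + t) (∣x*y*z∣≤ c c c ∣c∣≤B ∣c∣≤B ∣c∣≤B)))
                    (∣k*w∣≤ (+ 3 ℤ.* + t) (∣x*y*z∣≤ a b c ∣a∣≤B ∣b∣≤B ∣c∣≤B)) ⟩
    B³ ℕ.+ t ℕ.* B³ ℕ.+ ∣ + t ℤ.* + t ∣ ℕ.* B³ ℕ.+ ∣ + 3 ℤ.* + t ∣ ℕ.* B³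
      ≡⟨ cong₂ (λ u v → B³ ℕ.+ t ℕ.* B³ ℕ.+ u ℕ.* B³ ℕ.+ v ℕ.* B³) (abs-* (+ t) (+ t)) (abs-* (+ 3) (+ t)) ⟩
    B³ ℕ.+ t ℕ.* B³ ℕ.+ t ℕ.* t ℕ.* B³ ℕ.+ 3 ℕ.* t ℕ.* B³
      ≡⟨ collect t B³ ⟩
    (1 ℕ.+ t ℕ.+ t ℕ.* t ℕ.+ 3 ℕ.* t) ℕ.* B³ ∎
    where
    a³ = a ℤ.* a ℤ.* a
    T₁ = + t ℤ.* (b ℤ.* b ℤ.* b)
    T₂ = + t ℤ.* + t ℤ.* (c ℤ.* c ℤ.* c)
    T₃ = + 3 ℤ.* + t ℤ.* (a ℤ.* b ℤ.* c)
    B³ = B ℕ.* B ℕ.* B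
    collect : ∀ t X → X ℕ.+ t ℕ.* X ℕ.+ t ℕ.* t ℕ.* X ℕ.+ 3 ℕ.* t ℕ.* X ≡ (1 ℕ.+ t ℕ.+ t ℕ.* t ℕ.+ 3 ℕ.* t) ℕ.* X
    collect = solve-∀

  d∣i∧∣i∣<∣d∣⇒i≡0 : ∀ {d i} → d ∣ i → ∣ i ∣ < ∣ d ∣ → i ≡ 0ℤ
  d∣i∧∣i∣<∣d∣⇒i≡0 d∣i ∣i∣<∣d∣ = ∣i∣≡0⇒i≡0 (small-multiple (∣⇒∣ᵤ d∣i) ∣i∣<∣d∣)
    where
    small-multiple : ∀ {d n} → d ℕ.∣ n → n < d → n ≡ 0
    small-multiple {n = zero}  _   _   = refl
    small-multiple {n = suc n} d∣n n<d = contradiction d∣n (ℕ.>⇒∤ n<d)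

  cube<[m*n]² : ∀ {C m n} → 4 ℕ.* C < m → m ≤ 2 ℕ.* n → C ℕ.* (m ℕ.* m ℕ.* m) < m ℕ.* n ℕ.* (m ℕ.* n)
  cube<[m*n]² {C} {m@(suc _)} {n} 4C<m m≤2n = ℕ.*-cancelˡ-< 4 _ _ (begin-strict
    4 ℕ.* (C ℕ.* (m ℕ.* m ℕ.* m))        ≡⟨ ℕ.*-assoc 4 C _ ⟨
    4 ℕ.* C ℕ.* (m ℕ.* m ℕ.* m)          <⟨ ℕ.*-monoˡ-< (m ℕ.* m ℕ.* m) 4C<m ⟩
    m ℕ.* (m ℕ.* m ℕ.* m)                ≡⟨ regroup m ⟩
    m ℕ.* m ℕ.* (m ℕ.* m)                ≤⟨ ℕ.*-monoʳ-≤ (m ℕ.* m) (ℕ.*-mono-≤ m≤2n m≤2n) ⟩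
    m ℕ.* m ℕ.* (2 ℕ.* n ℕ.* (2 ℕ.* n))  ≡⟨ pull-4 m n ⟩
    4 ℕ.* (m ℕ.* n ℕ.* (m ℕ.* n))        ∎)
    where
    regroup : ∀ m → m ℕ.* (m ℕ.* m ℕ.* m) ≡ m ℕ.* m ℕ.* (m ℕ.* m)
    regroup = solve-∀
    pull-4 : ∀ m n → m ℕ.* m ℕ.* (2 ℕ.* n ℕ.* (2 ℕ.* n)) ≡ 4 ℕ.* (m ℕ.* n ℕ.* (m ℕ.* n))
    pull-4 = solve-∀

  -- ∣ N ∣ ≤ 13 (4m)³ = 832 m³, while (mn)² ≥ m⁴/4 exceeds this once m > 4 · 832.
  norm-vanishes : ∀ {m n x y z} → 3328 < m → m ≤ 2 ℕ.* n →
                  ∣ x ∣ ≤ 4 ℕ.* m → ∣ y ∣ ≤ 4 ℕ.* m → ∣ z ∣ ≤ 4 ℕ.* m →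
                  (+ m ℤ.* + n) ℤ.* (+ m ℤ.* + n) ∣ norm (+ 2) y x z → norm (+ 2) y x z ≡ 0ℤ
  norm-vanishes {m} {n} {x} {y} {z} 3328<m m≤2n ∣x∣≤4m ∣y∣≤4m ∣z∣≤4m [mn]²∣N =
    d∣i∧∣i∣<∣d∣⇒i≡0 [mn]²∣N (begin-strict
      ∣ norm (+ 2) y x z ∣                            ≤⟨ ∣norm∣≤ 2 y x z ∣y∣≤4m ∣x∣≤4m ∣z∣≤4m ⟩
      13 ℕ.* (4 ℕ.* m ℕ.* (4 ℕ.* m) ℕ.* (4 ℕ.* m))  ≡⟨ expand m ⟩
      832 ℕ.* (m ℕ.* m ℕ.* m)                        <⟨ cube<[m*n]² {C = 832} 3328<m m≤2n ⟩
      m ℕ.* n ℕ.* (m ℕ.* n)                          ≡⟨ cong₂ ℕ._*_ (abs-* (+ m) (+ n)) (abs-* (+ m) (+ n)) ⟨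
      ∣ + m ℤ.* + n ∣ ℕ.* ∣ + m ℤ.* + n ∣            ≡⟨ abs-* (+ m ℤ.* + n) (+ m ℤ.* + n) ⟨
      ∣ (+ m ℤ.* + n) ℤ.* (+ m ℤ.* + n) ∣            ∎)
    where
    expand : ∀ m → 13 ℕ.* (4 ℕ.* m ℕ.* (4 ℕ.* m) ℕ.* (4 ℕ.* m)) ≡ 832 ℕ.* (m ℕ.* m ℕ.* m)
    expand = solve-∀

module IntegerEmbedding where
  open import Defs using (fromℤ; _÷_)
  open import Data.Nat as ℕ using (suc; NonZero)
  import Data.Nat.Properties as ℕ
  open import Data.Integer as ℤ using (+_; -[1+_])
  import Data.Integer.Properties as ℤ
  open import Data.Integer.Tactic.RingSolver
  open import Data.Rational using (_+_; _*_; _-_; -_; _≤_; _<_; ∣_∣; 0ℚ; _/_; toℚᵘ)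
  import Data.Rational.Properties as ℚ
  import Data.Rational.Literals as Literal
  import Data.Rational.Unnormalised as ℚᵘ
  import Data.Rational.Unnormalised.Properties as ℚᵘ
  open import Relation.Binary.PropositionalEquality

  -- Unlike a / 1, the literal mkℚ a 0 is in normal form by construction, so ℚ's operations
  -- compute on it.
  fromℤ≡literal : ∀ a → fromℤ a ≡ Literal.fromℤ a
  fromℤ≡literal a = ℚ.↥p/↧p≡p (Literal.fromℤ a)

  fromℤ-* : ∀ a b → fromℤ (a ℤ.* b) ≡ fromℤ a * fromℤ b
  fromℤ-* a b = sym (cong₂ _*_ (fromℤ≡literal a) (fromℤ≡literal b))

  fromℤ-+ : ∀ a b → fromℤ (a ℤ.+ b) ≡ fromℤ a + fromℤ b
  fromℤ-+ a b = trans (cong (_/ 1) (cong₂ ℤ._+_ (sym (ℤ.*-identityʳ a)) (sym (ℤ.*-identityʳ b))))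
                      (sym (cong₂ _+_ (fromℤ≡literal a) (fromℤ≡literal b)))

  fromℤ-neg : ∀ a → fromℤ (ℤ.- a) ≡ - fromℤ a
  fromℤ-neg a = trans (fromℤ≡literal (ℤ.- a)) (trans (literal-neg a) (cong -_ (sym (fromℤ≡literal a))))
    where
    literal-neg : ∀ a → Literal.fromℤ (ℤ.- a) ≡ - Literal.fromℤ a
    literal-neg (+ 0)     = refl
    literal-neg (+ suc n) = refl
    literal-neg -[1+ n ]  = refl

  fromℤ-- : ∀ a b → fromℤ (a ℤ.- b) ≡ fromℤ a - fromℤ b
  fromℤ-- a b = trans (fromℤ-+ a (ℤ.- b)) (cong (λ q → fromℤ a + q) (fromℤ-neg b))

  fromℤ-cancel-≤ : ∀ {a b} → fromℤ a ≤ fromℤ b → a ℤ.≤ b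
  fromℤ-cancel-≤ {a} {b} a≤b rewrite fromℤ≡literal a | fromℤ≡literal b =
    subst₂ ℤ._≤_ (ℤ.*-identityʳ a) (ℤ.*-identityʳ b) (ℚ.drop-*≤* a≤b)

  fromℤ-cancel-< : ∀ {a b} → fromℤ a < fromℤ b → a ℤ.< b
  fromℤ-cancel-< {a} {b} a<b rewrite fromℤ≡literal a | fromℤ≡literal b =
    subst₂ ℤ._<_ (ℤ.*-identityʳ a) (ℤ.*-identityʳ b) (ℚ.drop-*<* a<b)

  0≤fromℤ : ∀ n → 0ℚ ≤ fromℤ (+ n)
  0≤fromℤ n rewrite fromℤ≡literal (+ n) = ℚ.nonNegative⁻¹ _

  0<fromℤ : ∀ n .{{_ : NonZero n}} → 0ℚ < fromℤ (+ n)
  0<fromℤ (suc n) rewrite fromℤ≡literal (+ suc n) = ℚ.positive⁻¹ _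

  ∣fromℤ∣ : ∀ a → ∣ fromℤ a ∣ ≡ fromℤ (+ ℤ.∣ a ∣)
  ∣fromℤ∣ a rewrite fromℤ≡literal a | fromℤ≡literal (+ ℤ.∣ a ∣) = refl

  fromℤ-*-÷ : ∀ {m} .{{_ : NonZero m}} i → fromℤ (+ m) * (i ÷ m) ≡ fromℤ i
  fromℤ-*-÷ {suc k} i = ℚ.toℚᵘ-injective (begin
    toℚᵘ (fromℤ (+ suc k) * (i / suc k))          ≈⟨ ℚ.toℚᵘ-homo-* (fromℤ (+ suc k)) (i / suc k) ⟩
    toℚᵘ (fromℤ (+ suc k)) ℚᵘ.* toℚᵘ (i / suc k)  ≈⟨ ℚᵘ.*-cong (ℚ.toℚᵘ-fromℚᵘ (ℚᵘ.mkℚᵘ (+ suc k) 0))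
                                                              (ℚ.toℚᵘ-fromℚᵘ (ℚᵘ.mkℚᵘ i k)) ⟩
    ℚᵘ.mkℚᵘ (+ suc k) 0 ℚᵘ.* ℚᵘ.mkℚᵘ i k          ≈⟨ ℚᵘ.*≡* (trans (cancel (+ suc k) i) denominator) ⟩
    ℚᵘ.mkℚᵘ i 0                                   ≈⟨ ℚ.toℚᵘ-fromℚᵘ (ℚᵘ.mkℚᵘ i 0) ⟨
    toℚᵘ (fromℤ i)                                ∎)
    where
    open ℚᵘ.≃-Reasoning
    cancel : ∀ m i → m ℤ.* i ℤ.* + 1 ≡ i ℤ.* m
    cancel = solve-∀
    denominator : i ℤ.* + suc k ≡ i ℤ.* + suc (k ℕ.+ 0)
    denominator = cong (λ d → i ℤ.* + suc d) (sym (ℕ.+-identityʳ k))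

module DiscGeometry where
  open import Defs using (fromℤ; _÷_; sq)
  open IntegerEmbedding
  open import Data.Nat as ℕ using (ℕ; NonZero)
  import Data.Nat.Properties as ℕ
  open import Data.Integer as ℤ using (ℤ; +_; 0ℤ)
  import Data.Integer.Properties as ℤ
  open import Data.Rational using (ℚ; _+_; _*_; _-_; -_; _≤_; _<_; ∣_∣; 0ℚ; 1ℚ; positive; nonNegative)
  import Data.Rational.Properties as ℚ
  open import Data.Rational.Solver using (module +-*-Solver)
  open +-*-Solver using (solve; _:=_; _:+_; _:*_; _:-_; :-_)
  open import Data.Sum using (inj₁; inj₂)
  open import Relation.Binary.PropositionalEquality
  open import Relation.Nullary using (yes; no; contradiction)

  p*p≡∣p∣*∣p∣ : ∀ p → p * p ≡ ∣ p ∣ * ∣ p ∣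
  p*p≡∣p∣*∣p∣ p with ℚ.∣p∣≡p∨∣p∣≡-p p
  ... | inj₁ ∣p∣≡p  = cong₂ _*_ (sym ∣p∣≡p) (sym ∣p∣≡p)
  ... | inj₂ ∣p∣≡-p = trans (neg-square p) (cong₂ _*_ (sym ∣p∣≡-p) (sym ∣p∣≡-p))
    where
    neg-square : ∀ p → p * p ≡ (- p) * (- p)
    neg-square = solve 1 (λ p → p :* p := (:- p) :* (:- p)) refl

  0≤p*p : ∀ p → 0ℚ ≤ p * p
  0≤p*p p = subst₂ _≤_ (ℚ.*-zeroʳ ∣ p ∣) (sym (p*p≡∣p∣*∣p∣ p))
    (ℚ.*-monoˡ-≤-nonNeg ∣ p ∣ {{nonNegative (ℚ.0≤∣p∣ p)}} (ℚ.0≤∣p∣ p))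

  p*p≤1⇒∣p∣≤1 : ∀ p → p * p ≤ 1ℚ → ∣ p ∣ ≤ 1ℚ
  p*p≤1⇒∣p∣≤1 p p²≤1 with ∣ p ∣ ℚ.≤? 1ℚ
  ... | yes ∣p∣≤1 = ∣p∣≤1
  ... | no  ∣p∣≰1 = contradiction (ℚ.<-≤-trans 1<∣p∣² ∣p∣²≤1) (ℚ.<-irrefl refl)
    where
    1<∣p∣ = ℚ.≰⇒> ∣p∣≰1
    ∣p∣²≤1 : ∣ p ∣ * ∣ p ∣ ≤ 1ℚ
    ∣p∣²≤1 = subst (_≤ 1ℚ) (p*p≡∣p∣*∣p∣ p) p²≤1
    1<∣p∣² : 1ℚ < ∣ p ∣ * ∣ p ∣
    1<∣p∣² = ℚ.<-≤-trans 1<∣p∣ (subst (_≤ ∣ p ∣ * ∣ p ∣) (ℚ.*-identityʳ ∣ p ∣)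
               (ℚ.*-monoˡ-≤-nonNeg ∣ p ∣ {{nonNegative (ℚ.0≤∣p∣ p)}} (ℚ.<⇒≤ 1<∣p∣)))

  ∣M*D∣≤1 : ∀ M D E → sq M * (sq D + sq E) ≤ 1ℚ → ∣ M * D ∣ ≤ 1ℚ
  ∣M*D∣≤1 M D E inside = p*p≤1⇒∣p∣≤1 (M * D) (ℚ.≤-trans [MD]²≤ (subst (_≤ 1ℚ) (expand M D E) inside))
    where
    [MD]²≤ : (M * D) * (M * D) ≤ (M * D) * (M * D) + (M * E) * (M * E)
    [MD]²≤ = subst (_≤ (M * D) * (M * D) + (M * E) * (M * E)) (ℚ.+-identityʳ _)
               (ℚ.+-monoʳ-≤ ((M * D) * (M * D)) (0≤p*p (M * E)))
    expand : ∀ M D E → M * M * (D * D + E * E) ≡ (M * D) * (M * D) + (M * E) * (M * E)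
    expand = solve 3 (λ M D E → M :* M :* (D :* D :+ E :* E) := (M :* D) :* (M :* D) :+ (M :* E) :* (M :* E)) refl

  ∣M*E∣≤1 : ∀ M D E → sq M * (sq D + sq E) ≤ 1ℚ → ∣ M * E ∣ ≤ 1ℚ
  ∣M*E∣≤1 M D E inside = ∣M*D∣≤1 M E D (subst (λ s → sq M * s ≤ 1ℚ) (ℚ.+-comm (sq D) (sq E)) inside)

  ≤2*-<⇒<2* : ∀ {M m n} → fromℤ (+ m) ≤ fromℤ (+ 2) * M → M < fromℤ (+ n) → m ℕ.< 2 ℕ.* n
  ≤2*-<⇒<2* {M} {m} {n} m≤2M M<n = ℤ.drop‿+<+ (fromℤ-cancel-< (ℚ.≤-<-trans m≤2M (begin-strict
    fromℤ (+ 2) * M            <⟨ ℚ.*-monoʳ-<-pos (fromℤ (+ 2)) {{positive (0<fromℤ 2)}} M<n ⟩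
    fromℤ (+ 2) * fromℤ (+ n)  ≡⟨ fromℤ-* (+ 2) (+ n) ⟨
    fromℤ (+ 2 ℤ.* + n)        ≡⟨ cong fromℤ (ℤ.pos-* 2 n) ⟨
    fromℤ (+ (2 ℕ.* n))        ∎)))
    where open ℚ.≤-Reasoning

  -- the integer m n ((i/m − a) − (j/n − b))
  gap : ℕ → ℕ → ℤ → ℤ → ℤ → ℤ → ℤ
  gap m n i j a b = + n ℤ.* (i ℤ.- a ℤ.* + m) ℤ.- + m ℤ.* (j ℤ.- b ℤ.* + n)

  module _ {m n : ℕ} .{{_ : NonZero m}} .{{_ : NonZero n}} (c : ℚ) (i j a b : ℤ) where

    private
      ιm = fromℤ (+ m)
      ιn = fromℤ (+ n)
      D₁ = i ÷ m - c - fromℤ a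
      D₂ = j ÷ n - c - fromℤ b

    fromℤ-gap : fromℤ (gap m n i j a b) ≡ ιm * ιn * (D₁ - D₂)
    fromℤ-gap = begin
      fromℤ (+ n ℤ.* (i ℤ.- a ℤ.* + m) ℤ.- + m ℤ.* (j ℤ.- b ℤ.* + n))
        ≡⟨ trans (fromℤ-- (+ n ℤ.* (i ℤ.- a ℤ.* + m)) (+ m ℤ.* (j ℤ.- b ℤ.* + n)))
                 (cong₂ _-_ (fromℤ-[k*[x-y*l]] (+ n) i a (+ m)) (fromℤ-[k*[x-y*l]] (+ m) j b (+ n))) ⟩
      ιn * (fromℤ i - fromℤ a * ιm) - ιm * (fromℤ j - fromℤ b * ιn)
        ≡⟨ cong₂ (λ u v → ιn * (u - fromℤ a * ιm) - ιm * (v - fromℤ b * ιn))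
                 (sym (fromℤ-*-÷ i)) (sym (fromℤ-*-÷ j)) ⟩
      ιn * (ιm * (i ÷ m) - fromℤ a * ιm) - ιm * (ιn * (j ÷ n) - fromℤ b * ιn)
        ≡⟨ regroup ιm ιn (i ÷ m) (j ÷ n) c (fromℤ a) (fromℤ b) ⟩
      ιm * ιn * (D₁ - D₂) ∎
      where
      open ≡-Reasoning
      fromℤ-[k*[x-y*l]] : ∀ k x y l → fromℤ (k ℤ.* (x ℤ.- y ℤ.* l)) ≡ fromℤ k * (fromℤ x - fromℤ y * fromℤ l)
      fromℤ-[k*[x-y*l]] k x y l = trans (fromℤ-* k (x ℤ.- y ℤ.* l))
        (cong (fromℤ k *_) (trans (fromℤ-- x (y ℤ.* l)) (cong (λ q → fromℤ x - q) (fromℤ-* y l))))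
      regroup : ∀ ιm ιn x y c A B →
        ιn * (ιm * x - A * ιm) - ιm * (ιn * y - B * ιn) ≡ ιm * ιn * ((x - c - A) - (y - c - B))
      regroup = solve 7 (λ ιm ιn x y c A B →
        ιn :* (ιm :* x :- A :* ιm) :- ιm :* (ιn :* y :- B :* ιn) := ιm :* ιn :* ((x :- c :- A) :- (y :- c :- B))) refl

    ∣gap∣≤ : ∀ {M} → 0ℚ ≤ M → ∣ M * D₁ ∣ ≤ 1ℚ → ∣ M * D₂ ∣ ≤ 1ℚ → ιn ≤ fromℤ (+ 2) * M →
             ℤ.∣ gap m n i j a b ∣ ℕ.≤ 4 ℕ.* m
    ∣gap∣≤ {M} 0≤M ∣MD₁∣≤1 ∣MD₂∣≤1 n≤2M = ℤ.drop‿+≤+ (fromℤ-cancel-≤ (begin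
      fromℤ (+ ℤ.∣ gap m n i j a b ∣)  ≡⟨ ∣fromℤ∣ (gap m n i j a b) ⟨
      ∣ fromℤ (gap m n i j a b) ∣      ≡⟨ cong ∣_∣ fromℤ-gap ⟩
      ∣ ιm * ιn * X ∣                  ≡⟨ ℚ.∣p*q∣≡∣p∣*∣q∣ (ιm * ιn) X ⟩
      ∣ ιm * ιn ∣ * ∣ X ∣              ≡⟨ cong (_* ∣ X ∣) (ℚ.0≤p⇒∣p∣≡p (ℚ.nonNegative⁻¹ (ιm * ιn))) ⟩
      ιm * ιn * ∣ X ∣                  ≡⟨ ℚ.*-assoc ιm ιn ∣ X ∣ ⟩
      ιm * (ιn * ∣ X ∣)                ≤⟨ ℚ.*-monoˡ-≤-nonNeg ιm (ℚ.*-monoʳ-≤-nonNeg ∣ X ∣ n≤2M) ⟩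
      ιm * (fromℤ (+ 2) * M * ∣ X ∣)   ≡⟨ cong (ιm *_) (trans (ℚ.*-assoc (fromℤ (+ 2)) M ∣ X ∣)
                                                              (cong (fromℤ (+ 2) *_) (sym ∣M*X∣≡M*∣X∣))) ⟩
      ιm * (fromℤ (+ 2) * ∣ M * X ∣)   ≤⟨ ℚ.*-monoˡ-≤-nonNeg ιm (ℚ.*-monoˡ-≤-nonNeg (fromℤ (+ 2)) ∣M*X∣≤2) ⟩
      ιm * (fromℤ (+ 2) * (1ℚ + 1ℚ))   ≡⟨ fromℤ-* (+ m) (+ 4) ⟨
      fromℤ (+ m ℤ.* + 4)              ≡⟨ cong fromℤ (trans (cong +_ (ℕ.*-comm 4 m)) (ℤ.pos-* m 4)) ⟨
      fromℤ (+ (4 ℕ.* m))              ∎))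
      where
      open ℚ.≤-Reasoning
      X = D₁ - D₂
      instance
        _ = nonNegative (0≤fromℤ m)
        _ = nonNegative (0≤fromℤ n)
        _ = nonNegative (0≤fromℤ 2)
        _ = nonNegative (ℚ.0≤∣p∣ X)
        _ = ℚ.nonNeg*nonNeg⇒nonNeg ιm ιn
      ∣M*X∣≡M*∣X∣ : ∣ M * X ∣ ≡ M * ∣ X ∣
      ∣M*X∣≡M*∣X∣ = trans (ℚ.∣p*q∣≡∣p∣*∣q∣ M X) (cong (_* ∣ X ∣) (ℚ.0≤p⇒∣p∣≡p 0≤M))
      ∣M*X∣≤2 : ∣ M * X ∣ ≤ 1ℚ + 1ℚ
      ∣M*X∣≤2 = ℚ.≤-trans (ℚ.≤-reflexive (cong ∣_∣ (distrib M D₁ D₂)))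
                  (ℚ.≤-trans (ℚ.∣p-q∣≤∣p∣+∣q∣ (M * D₁) (M * D₂)) (ℚ.+-mono-≤ ∣MD₁∣≤1 ∣MD₂∣≤1))
        where
        distrib : ∀ M x y → M * (x - y) ≡ M * x - M * y
        distrib = solve 3 (λ M x y → M :* (x :- y) := M :* x :- M :* y) refl

    gap≡0⇒ : gap m n i j a b ≡ 0ℤ → i ÷ m - j ÷ n ≡ fromℤ (a ℤ.- b)
    gap≡0⇒ gap≡0 = begin
      i ÷ m - j ÷ n                    ≡⟨ split (i ÷ m) (j ÷ n) c (fromℤ a) (fromℤ b) ⟩
      (D₁ - D₂) + (fromℤ a - fromℤ b)  ≡⟨ cong (_+ (fromℤ a - fromℤ b)) D₁-D₂≡0 ⟩
      0ℚ + (fromℤ a - fromℤ b)         ≡⟨ ℚ.+-identityˡ _ ⟩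
      fromℤ a - fromℤ b                ≡⟨ fromℤ-- a b ⟨
      fromℤ (a ℤ.- b)                  ∎
      where
      open ≡-Reasoning
      instance
        _ = positive (0<fromℤ m)
        _ = positive (0<fromℤ n)
        _ = ℚ.pos*pos⇒pos ιm ιn
      ιm*ιn*[D₁-D₂]≡0 : ιm * ιn * (D₁ - D₂) ≡ 0ℚ
      ιm*ιn*[D₁-D₂]≡0 = trans (sym fromℤ-gap) (cong fromℤ gap≡0)
      D₁-D₂≡0 : D₁ - D₂ ≡ 0ℚ
      D₁-D₂≡0 = ℚ.≤-antisym
        (ℚ.*-cancelˡ-≤-pos (ιm * ιn) (ℚ.≤-reflexive (trans ιm*ιn*[D₁-D₂]≡0 (sym (ℚ.*-zeroʳ (ιm * ιn))))))
        (ℚ.*-cancelˡ-≤-pos (ιm * ιn) (ℚ.≤-reflexive (trans (ℚ.*-zeroʳ (ιm * ιn)) (sym ιm*ιn*[D₁-D₂]≡0))))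
      split : ∀ x y c A B → x - y ≡ ((x - c - A) - (y - c - B)) + (A - B)
      split = solve 5 (λ x y c A B → x :- y := ((x :- c :- A) :- (y :- c :- B)) :+ (A :- B)) refl

module Counting where
  open import Data.Nat using (_≤_; z≤n; s≤s)
  open import Data.Nat.Properties using (_≤?_; ≰⇒>)
  open import Data.Fin using (Fin; zero; suc)
  open import Data.Fin.Properties using (pigeonhole)
  import Data.Fin.Base as Fin
  open import Data.List using ([]; _∷_; length; lookup)
  open import Data.List.Membership.Propositional.Properties using (∈-lookup)
  open import Data.List.Relation.Unary.All as All using (All; _∷_)
  open import Data.List.Relation.Unary.AllPairs using (AllPairs; []; _∷_)
  open import Data.Product using (_,_)
  open import Relation.Binary.PropositionalEquality using (_≢_)
  open import Relation.Nullary using (¬_; yes; no; contradiction)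

  module _ {A : Set} {R : A → A → Set} where

    AllPairs-lookup : ∀ {xs} → AllPairs R xs → ∀ {i j : Fin (length xs)} → i Fin.< j →
                      R (lookup xs i) (lookup xs j)
    AllPairs-lookup (Rx ∷ _)   {zero}  {suc j} _         = All.lookup Rx (∈-lookup j)
    AllPairs-lookup (_ ∷ Rxs)  {suc i} {suc j} (s≤s i<j) = AllPairs-lookup Rxs i<j

    AllPairs⇒length≤ : ∀ {N} (f : A → Fin N) → (∀ {x y} → R x y → f x ≢ f y) →
                       ∀ {xs} → AllPairs R xs → length xs ≤ N
    AllPairs⇒length≤ {N} f separates {xs} Rxs with length xs ≤? N
    ... | yes ≤N = ≤N
    ... | no  ≰N with i , j , i<j , fxᵢ≡fxⱼ ← pigeonhole (≰⇒> ≰N) (λ i → f (lookup xs i))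
      = contradiction fxᵢ≡fxⱼ (separates (AllPairs-lookup Rxs i<j))

    All∧AllPairs⇒length≤1 : ∀ {P : A → Set} → (∀ {x y} → P x → P y → ¬ R x y) →
                            ∀ {xs} → All P xs → AllPairs R xs → length xs ≤ 1
    All∧AllPairs⇒length≤1 _    {[]}        _             _               = z≤n
    All∧AllPairs⇒length≤1 _    {_ ∷ []}    _             _               = s≤s z≤n
    All∧AllPairs⇒length≤1 P⇒¬R {_ ∷ _ ∷ _} (Px ∷ Py ∷ _) ((Rxy ∷ _) ∷ _) = contradiction Rxy (P⇒¬R Px Py)

open import Defs
open import Data.Nat using (ℕ)
open import Data.Rational using (ℚ; 1ℚ) renaming (_≤_ to _≤ℚ_)
open import Data.List using (List; length)
open import Data.List.Relation.Unary.All using (All)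
open import Data.List.Relation.Unary.AllPairs using (AllPairs)
open import Data.Product using (∃-syntax)
open import Relation.Nullary using (¬_)
open import Data.Nat using (_≤_)

open import Data.Nat as ℕ using (suc; _<_; z≤n; s≤s)
import Data.Nat.Properties as ℕ
open import Data.Nat.Primality using (prime[2])
open import Data.Integer as ℤ using (+_; 0ℤ)
import Data.Integer.Properties as ℤ
open import Data.Integer.Divisibility.Signed using (_∣_; ∣ᵤ⇒∣)
import Data.Rational as ℚ
import Data.Rational.Properties as ℚ
open import Data.Fin using (Fin; toℕ; fromℕ<; combine)
import Data.Fin.Properties as Fin
open import Data.Product using (_,_; proj₁; proj₂)
open import Relation.Binary.PropositionalEquality
open import Relation.Nullary using (Dec; yes; no)
open CubicNorm
open NormAnisotropy
open NormBound
open IntegerEmbedding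
open DiscGeometry
open Counting

≡⇒~ : ∀ {p q} → p ≡ q → p ~ q
≡⇒~ {x , y} refl = (0ℤ , ℚ.+-inverseʳ x) , (0ℤ , ℚ.+-inverseʳ y)

∣n*1-m*1∣≤4m : ∀ {m n} → n < 2 ℕ.* m → ℤ.∣ + n ℤ.* + 1 ℤ.- + m ℤ.* + 1 ∣ ≤ 4 ℕ.* m
∣n*1-m*1∣≤4m {m} {n} n<2m = begin
  ℤ.∣ + n ℤ.* + 1 ℤ.- + m ℤ.* + 1 ∣        ≤⟨ ℤ.∣i-j∣≤∣i∣+∣j∣ (+ n ℤ.* + 1) (+ m ℤ.* + 1) ⟩
  ℤ.∣ + n ℤ.* + 1 ∣ ℕ.+ ℤ.∣ + m ℤ.* + 1 ∣  ≡⟨ cong₂ (λ i j → ℤ.∣ i ∣ ℕ.+ ℤ.∣ j ∣)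
                                                     (ℤ.*-identityʳ (+ n)) (ℤ.*-identityʳ (+ m)) ⟩
  n ℕ.+ m                                  ≤⟨ ℕ.+-monoˡ-≤ m (ℕ.<⇒≤ n<2m) ⟩
  2 ℕ.* m ℕ.+ m                            ≡⟨ ℕ.+-comm (2 ℕ.* m) m ⟩
  3 ℕ.* m                                  ≤⟨ ℕ.*-monoˡ-≤ m (ℕ.m≤n+m 3 1) ⟩
  4 ℕ.* m                                  ∎
  where open ℕ.≤-Reasoning

K : ℕ
K = 3328

-- With P ≡ ν and Q ≡ ν² (mod m) the shifted numerators, the three arguments of norm are the
-- coordinates of n (Q₁, P₁, 1) − m (Q₂, P₂, 1).
norm-gaps-∣ : ∀ {m n} ν μ a₁ b₁ a₂ b₂ → + m ∣ ν ℤ.* ν ℤ.* ν ℤ.- + 2 → + n ∣ μ ℤ.* μ ℤ.* μ ℤ.- + 2 →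
  (+ m ℤ.* + n) ℤ.* (+ m ℤ.* + n)
    ∣ norm (+ 2) (gap m n (ν ℤ.* ν) (μ ℤ.* μ) b₁ b₂) (gap m n ν μ a₁ a₂) (+ n ℤ.* + 1 ℤ.- + m ℤ.* + 1)
norm-gaps-∣ {m} {n} ν μ a₁ b₁ a₂ b₂ m∣ν³-2 n∣μ³-2 =
  norm-[n*α-m*β]-∣ {+ 2} {+ m} {+ n} {Q₁} {P₁} {+ 1} {Q₂} {P₂} {+ 1}
    (norm-at-root  {+ 2} {+ m} {P₁} {Q₁} root₁ square₁)
    (norm′-at-root {+ 2} {+ m} {P₁} {Q₁} root₁ square₁ Q₂ P₂ (+ 1))
    (norm-at-root  {+ 2} {+ n} {P₂} {Q₂} root₂ square₂)
    (norm′-at-root {+ 2} {+ n} {P₂} {Q₂} root₂ square₂ Q₁ P₁ (+ 1))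
  where
  P₁ = ν ℤ.- a₁ ℤ.* + m
  Q₁ = ν ℤ.* ν ℤ.- b₁ ℤ.* + m
  P₂ = μ ℤ.- a₂ ℤ.* + n
  Q₂ = μ ℤ.* μ ℤ.- b₂ ℤ.* + n
  root₁ : + m ∣ P₁ ℤ.* P₁ ℤ.* P₁ ℤ.- + 2
  root₁ = cube-root-shift {+ 2} {+ m} {ν} a₁ m∣ν³-2
  root₂ : + n ∣ P₂ ℤ.* P₂ ℤ.* P₂ ℤ.- + 2
  root₂ = cube-root-shift {+ 2} {+ n} {μ} a₂ n∣μ³-2
  square₁ = square-shift (+ m) ν a₁ b₁
  square₂ = square-shift (+ n) μ a₂ b₂

same-disc⇒~ : ∀ {M c} → fromℤ (+ K) ≤ℚ M → (s t : SIndex M) →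
              InDisc M c (point s) → InDisc M c (point t) → point s ~ point t
same-disc⇒~ {M} {c₁ , c₂} K≤M (sidx m@(suc _) ν M<m m≤2M m∣ν³-2) (sidx n@(suc _) μ M<n n≤2M n∣μ³-2)
            (a₁ , b₁ , s∈D) (a₂ , b₂ , t∈D) =
  (a₁ ℤ.- a₂ , gap≡0⇒ c₁ ν′ μ′ a₁ a₂ x≡0) , (b₁ ℤ.- b₂ , gap≡0⇒ c₂ (ν′ ℤ.* ν′) (μ′ ℤ.* μ′) b₁ b₂ y≡0)
  where
  ν′ = + toℕ ν
  μ′ = + toℕ μ
  x = gap m n ν′ μ′ a₁ a₂
  y = gap m n (ν′ ℤ.* ν′) (μ′ ℤ.* μ′) b₁ b₂
  z = + n ℤ.* + 1 ℤ.- + m ℤ.* + 1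
  0≤M = ℚ.≤-trans (0≤fromℤ K) K≤M
  D₁ = ν′ ÷ m ℚ.- c₁ ℚ.- fromℤ a₁
  E₁ = (ν′ ℤ.* ν′) ÷ m ℚ.- c₂ ℚ.- fromℤ b₁
  D₂ = μ′ ÷ n ℚ.- c₁ ℚ.- fromℤ a₂
  E₂ = (μ′ ℤ.* μ′) ÷ n ℚ.- c₂ ℚ.- fromℤ b₂
  ∣x∣≤4m : ℤ.∣ x ∣ ≤ 4 ℕ.* m
  ∣x∣≤4m = ∣gap∣≤ c₁ ν′ μ′ a₁ a₂ 0≤M (∣M*D∣≤1 M D₁ E₁ s∈D) (∣M*D∣≤1 M D₂ E₂ t∈D) n≤2M
  ∣y∣≤4m : ℤ.∣ y ∣ ≤ 4 ℕ.* m
  ∣y∣≤4m = ∣gap∣≤ c₂ (ν′ ℤ.* ν′) (μ′ ℤ.* μ′) b₁ b₂ 0≤M (∣M*E∣≤1 M D₁ E₁ s∈D) (∣M*E∣≤1 M D₂ E₂ t∈D) n≤2M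
  N≡0 : norm (+ 2) y x z ≡ 0ℤ
  N≡0 = norm-vanishes {m} {n} {x} {y} {z}
    (ℤ.drop‿+<+ (fromℤ-cancel-< {+ K} {+ m} (ℚ.≤-<-trans K≤M M<m)))
    (ℕ.<⇒≤ (≤2*-<⇒<2* {M} {m} {n} m≤2M M<n))
    ∣x∣≤4m ∣y∣≤4m (∣n*1-m*1∣≤4m {m} {n} (≤2*-<⇒<2* {M} {n} {m} n≤2M M<m))
    (norm-gaps-∣ ν′ μ′ a₁ b₁ a₂ b₂ (∣ᵤ⇒∣ m∣ν³-2) (∣ᵤ⇒∣ n∣μ³-2))
  x≡0 : x ≡ 0ℤ
  x≡0 = norm≡0⇒b≡0 prime[2] {y} {x} {z} N≡0
  y≡0 : y ≡ 0ℤ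
  y≡0 = norm≡0⇒a≡0 prime[2] {y} {x} {z} N≡0

point-cong : ∀ {M} (s t : SIndex M) → SIndex.m s ≡ SIndex.m t → toℕ (SIndex.ν s) ≡ toℕ (SIndex.ν t) →
             point s ≡ point t
point-cong (sidx m _ _ _ _) (sidx .m _ _ _ _) refl ν≡μ = cong (λ k → ((+ k) ÷ m , (+ k ℤ.* + k) ÷ m)) ν≡μ

module _ {M : ℚ} (M<K : M ℚ.< fromℤ (+ K)) where

  m<2K : (s : SIndex M) → SIndex.m s < 2 ℕ.* K
  m<2K s = ≤2*-<⇒<2* {M} {SIndex.m s} {K} (SIndex.m≤2M s) M<K

  ν<2K : (s : SIndex M) → toℕ (SIndex.ν s) < 2 ℕ.* K
  ν<2K s = ℕ.<-trans (Fin.toℕ<n (SIndex.ν s)) (m<2K s)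

  code : SIndex M → Fin (2 ℕ.* K ℕ.* (2 ℕ.* K))
  code s = combine (fromℕ< (m<2K s)) (fromℕ< (ν<2K s))

  code-injective : ∀ s t → code s ≡ code t → point s ≡ point t
  code-injective s t code≡ = point-cong s t
    (Fin.fromℕ<-injective _ _ (m<2K s) (m<2K t) (proj₁ m≡n×ν≡μ))
    (Fin.fromℕ<-injective _ _ (ν<2K s) (ν<2K t) (proj₂ m≡n×ν≡μ))
    where
    m≡n×ν≡μ = Fin.combine-injective {2 ℕ.* K} {2 ℕ.* K}
      (fromℕ< (m<2K s)) (fromℕ< (ν<2K s)) (fromℕ< (m<2K t)) (fromℕ< (ν<2K t)) code≡

length≤1 : ∀ {M c} → fromℤ (+ K) ≤ℚ M → (xs : List (SIndex M)) → All (λ s → InDisc M c (point s)) xs →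
           AllPairs (λ s t → ¬ (point s ~ point t)) xs → length xs ≤ 1
length≤1 K≤M xs in-disc distinct =
  All∧AllPairs⇒length≤1 (λ {s} {t} s∈D t∈D s≁t → s≁t (same-disc⇒~ K≤M s t s∈D t∈D)) in-disc distinct

length≤[2K]² : ∀ {M} → M ℚ.< fromℤ (+ K) → (xs : List (SIndex M)) →
               AllPairs (λ s t → ¬ (point s ~ point t)) xs → length xs ≤ 2 ℕ.* K ℕ.* (2 ℕ.* K)
length≤[2K]² M<K xs distinct =
  AllPairs⇒length≤ (code M<K) (λ {s} {t} s≁t code≡ → s≁t (≡⇒~ (code-injective M<K s t code≡))) distinct

theorem2 : ∃[ C ] ((M : ℚ) → 1ℚ ≤ℚ M → (c : Pt) → (xs : List (SIndex M)) → All (λ s → InDisc M c (point s)) xs → AllPairs (λ s t → ¬ (point s ~ point t)) xs → length xs ≤ C)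
theorem2 = 2 ℕ.* K ℕ.* (2 ℕ.* K) , λ M _ c xs in-disc distinct → by-size M c xs in-disc distinct (fromℤ (+ K) ℚ.≤? M)
  where
  by-size : ∀ M c xs → All (λ s → InDisc M c (point s)) xs → AllPairs (λ s t → ¬ (point s ~ point t)) xs →
            Dec (fromℤ (+ K) ≤ℚ M) → length xs ≤ 2 ℕ.* K ℕ.* (2 ℕ.* K)
  by-size M c xs in-disc distinct (yes K≤M) = ℕ.≤-trans (length≤1 K≤M xs in-disc distinct) (s≤s z≤n)
  by-size M c xs in-disc distinct (no  K≰M) = length≤[2K]² (ℚ.≰⇒> K≰M) xs distinct
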